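{- Let $N$ be a thread Petri net (t-net), let $M$ be a reachable marking of $N$, and let $R\in\mathit{repr}(M)$ be any pid-tree representation of $M$. Then $$\mathit{pid}_M\cup\mathit{nextpid}_M\;\subseteq\;\mathit{pid}(R)\setminus\{\langle\rangle\}\;\subseteq\;\Big(\bigcup_{\pi\in\mathit{pid}_M}\mathit{subpid}(\pi)\Big)\cup\mathit{nextpid}_M .$$
   Context: Process identifiers (pids). $\mathbb{P}=(\mathbb{N}^+)^*$ is the set of finite tuples of positive integers, including the empty tuple $\langle\rangle$; it is a monoid under concatenation. $\langle a_1,\dots,a_n\rangle$ is written $a_1.a_2.\cdots.a_n$. For $\pi=\langle a_1,\dots,a_n\rangle$: $\mathit{length}(\pi)=n$; $\mathit{prefix}(\pi)=\langle a_1,\dots,a_{n-1}\rangle$ if $n>0$ and $\langle\rangle$ otherwise; $\mathit{subpid}(\pi)=\{\pi\}\cup\mathit{subpid}(\mathit{prefix}(\pi))$ if $n>0$ and $\emptyset$ if $n=0$ (the nonempty prefixes of $\pi$, including $\pi$). Relations: $\pi\sphericalangle_1\pi'$ iff $\pi'=\pi.a$ for some $a\in\mathbb N^+$; $\pi\sphericalangle\pi'$ iff $\pi'=\pi.a_1.\cdots.a_n$ for some $n\ge1$, $a_i\in\mathbb N^+$; $\pi\pitchfork_1\pi'$ iff $\pi=\pi''.i$, $\pi'=\pi''.(i+1)$ for some $\pi''\neq\langle\rangle$, $i\in\mathbb N^+$; $\pi\pitchfork\pi'$ iff $\pi=\pi''.i$, $\pi'=\pi''.j$ for some $\pi''\ne\langle\rangle$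 and $i<j$. $\mathbb P$ is totally ordered hierarchically: first by length, then lexicographically. Coloured Petri nets. Fix a set $\mathbb D$ of data values (containing $\mathbb N$, disjoint from $\mathbb P$), a set $\mathbb V$ of variables and a set $\mathbb E\supseteq\mathbb V\cup\mathbb D$ of expressions containing Boolean expressions. A binding is a partial map $\beta:\mathbb V\to\mathbb P\cup\mathbb D$, extended to evaluation of expressions and of (multi)sets of expressions. A Petri net is $(S,T,\ell)$ with $S$ (places) and $T$ (transitions) finite and disjoint; for $s\in S$, $\ell(s)$ is a type $X_1\times\dots\times X_k$ ($k\ge1$, each $X_i\in\{\mathbb P,\mathbb D\}$); for $t\in T$, $\ell(t)\in\mathbb E$ is its guard; for $(x,y)\in(S\times T)\cup(T\times S)$, $\ell(x,y)$ is a multiset over $\mathbb E$. A marking maps each place $s$ to a multiset of values (tokens) of type $\ell(s)$. $M\xrightarrow{t,\beta}M'$ iff for all $s$: $M(s)\ge\beta(\ell(s,t))$, $\beta(\ell(t,s))$ is a multiset over $\ell(s)$, $M'(s)=M(s)-\beta(\ell(s,t))+\beta(\ell(t,s))$, and $\beta(\ell(t))$ is true. A t-net is such a net satisfying: (1) there is a unique generator place $s_\eta$, of type $\mathbb P\times\mathbb N$; (2) in the initial marking $M_0$, $s_\eta$ contains exactly the token $\langle\langle1\rangle,0\rangle$ and all other places are empty or contain only data values; (3) for each $t$, $\ell(s_\eta,t)=\{\langle p_1,c_1\rangle,\dots,\langle p_k,c_k\rangle\}$ ($k\ge0$, all $p_i,c_i$ distinct variables) and $\ell(t,s_\eta)=\{\langle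 p_1,c_1+n_1\rangle,\dots,\langle p_m,c_m+n_m\rangle\}\cup\{\langle p_i.(c_i+j),0\rangle:1\le i\le k,1\le j\le n_i\}$ with $m\le k$, $n_i\ge0$; $\Pi_t$ denotes the set of the $p_i.(c_i+j)$; (4) for $s\ne s_\eta$, $\ell(s,t)$ is a multiset of vectors of variables and data values, and $\ell(t,s)$ a multiset of vectors built from expressions over data variables and data values and from elements of $\Pi_t\cup\{p_1,\dots,p_m\}$; (5) $\ell(t)$ is a computable Boolean expression over the variables of arcs adjacent to $t$ and data values, in which pids (elements of $\Pi_t\cup\{p_1,\dots,p_k\}$) are only compared using $=,\sphericalangle_1,\sphericalangle,\pitchfork_1,\pitchfork$. A marking is reachable if obtained from $M_0$ by finitely many firings. States. For a reachable $M$: $\eta_M=\{\pi\mapsto k:\langle\pi,k\rangle\in M(s_\eta)\}$; for $\pi\in\mathrm{dom}(\eta_M)$, $\mathit{next}_M(\pi)=\pi.(\eta_M(\pi)+1)$; $\mathit{nextpid}_M=\{\mathit{next}_M(\pi):\pi\in\mathrm{dom}(\eta_M)\}$; $\mathit{pid}_M$ is the set of all pids occurring in tokens of $M$ in any place (including $s_\eta$); such pids are called active at $M$. Pid-trees. $\Xi$ is the least set such that $\langle M,C\rangle\in\Xi$ whenever $M$ is a marking and $C=\langle\langle a_1,t_1\rangle,\dots,\langle a_n,t_n\rangle\rangle$ with $n\ge0$, $t_i\in\Xi$, $a_i\in\mathbb P\setminus\{\langle\rangle\}$, and for $i\ne j$: $a_i\ne a_j$, $a_i\notin\mathit{subpid}(a_j)$,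 $a_j\notin\mathit{subpid}(a_i)$. It is written $M\xrightarrow{a_1,\dots,a_n}\langle t_1,\dots,t_n\rangle$ and $M$ is its root marking $M_t$. Inclusion: $\langle M',\langle\langle a'_1,t'_1\rangle,\dots,\langle a'_m,t'_m\rangle\rangle\rangle\subseteq\langle M,\langle\langle a_1,t_1\rangle,\dots,\langle a_n,t_n\rangle\rangle\rangle$ iff $M'\le M$ and for each $i$ there is $j$ with $a'_i=a_j$ and $t'_i\subseteq t_j$. Subtrees: $\langle\langle\rangle,t_0\rangle\in\mathit{Trees}(t_0)$, and if $t_0=M\xrightarrow{a_1,\dots,a_n}\langle t_1,\dots,t_n\rangle$ and $\langle\pi',t\rangle\in\mathit{Trees}(t_i)$ then $\langle a_i.\pi',t\rangle\in\mathit{Trees}(t_0)$. $\mathit{pid}(t)=\{\pi:\langle\pi,t'\rangle\in\mathit{Trees}(t)\}$ (it always contains $\langle\rangle$). A path labelled by a pid $\pi$ and decorated by a marking $M'$ is a pid-tree $t$ with $\pi\in\mathit{pid}(t)\subseteq\mathit{subpid}(\pi)\cup\{\langle\rangle\}$, $\langle\pi,\langle M',\langle\rangle\rangle\rangle\in\mathit{Trees}(t)$, and all other node markings empty; "$R$ contains $\mathit{path}(\pi,M')$" means some such path is $\subseteq R$; $\mathit{path}(\pi)=\mathit{path}(\pi,\emptyset)$. A pid-tree is sibling ordered if at every node its child labels satisfy $a_1\le\dots\le a_n$ in the hierarchical order. Representations. For a reachable marking $M$ of a t-net, $\mathit{repr}(M)$ is the set of sibling ordered pid-trees $R$ built so that,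 for each place $s$ of type $X_1\times\dots\times X_n$ and each token $v=\langle x_1,\dots,x_n\rangle\in M(s)$, exactly one of the following rules is applied, and $R$ contains nothing (no node, no token) beyond what these rules require (tokens deposited with multiplicity): generator rule: if $s=s_\eta$, $v=\langle\pi,i\rangle$, then $R$ contains $\mathit{path}(\pi)$ and $\mathit{path}(\pi.(i+1))$; shared-token rule: if $X_1=\mathbb D$, then $R$ contains $\mathit{path}(\langle\rangle,\{(s,v)\})$ (the marking with the single token $v$ in $s$) and $\mathit{path}(x_i)$ for each $i$ with $X_i=\mathbb P$; owned-token rule: if $X_1=\mathbb P$, then $R$ contains $\mathit{path}(x_1,\{(s,v)\})$ and $\mathit{path}(x_i)$ for each $i$ with $X_i=\mathbb P$. -}

module Defs where

open import Data.Nat using (ℕ; zero; suc; _+_; _<_; _≤_)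
open import Data.Nat.Properties using () renaming (_≟_ to _≟ℕ_)
open import Data.Fin using (Fin; toℕ; inject≤) renaming (_≟_ to _≟F_)
open import Data.List using (List; []; _∷_; _++_; [_]; length; map; tabulate; concat; filter)
open import Data.List.Properties using (≡-dec)
open import Data.List.Membership.Propositional using (_∈_)
open import Data.List.Relation.Unary.All using (All)
open import Data.List.Relation.Unary.Any using (Any)
open import Data.List.Relation.Unary.AllPairs using (AllPairs)
open import Data.List.Relation.Unary.Linked using (Linked)
open import Data.List.Relation.Binary.Pointwise using (Pointwise)
open import Data.List.Relation.Binary.Permutation.Propositional using (_↭_)
open import Data.Maybe using (Maybe; just; nothing)
open import Data.Bool using (Bool; T)
open import Data.Product using (Σ; ∃; _×_; _,_; proj₁; proj₂)
open import Data.Sum using (_⊎_)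
open import Data.Unit using (⊤)
open import Relation.Binary.PropositionalEquality using (_≡_; _≢_; refl; cong)
open import Relation.Binary.Construct.Closure.ReflexiveTransitive using (Star)
open import Relation.Binary.Definitions using (DecidableEquality)
open import Relation.Nullary using (¬_; yes; no; Dec)

-- A positive integer; `1+ n` denotes the positive integer n + 1.
record ℕ⁺ : Set where
  constructor 1+
  field pred : ℕ
open ℕ⁺ public

val⁺ : ℕ⁺ → ℕ
val⁺ a = suc (pred a)

_≟⁺_ : DecidableEquality ℕ⁺
1+ m ≟⁺ 1+ n with m ≟ℕ n
... | yes refl = yes refl
... | no m≢n = no λ { refl → m≢n refl }

-- ℙ = (ℕ⁺)*, the empty list being ⟨⟩; concatenation is _++_
Pid : Set
Pid = List ℕ⁺

_≟ₚ_ : DecidableEquality Pid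
_≟ₚ_ = ≡-dec _≟⁺_

prefix : Pid → Pid
prefix [] = []
prefix (a ∷ []) = []
prefix (a ∷ b ∷ π) = a ∷ prefix (b ∷ π)

-- subpid(π): the nonempty prefixes of π (including π itself).
-- (structural recursion equal to subpid(π) = {π} ∪ subpid(prefix π))
subpid : Pid → List Pid
subpid [] = []
subpid (a ∷ π) = [ a ∷ [] ] ++ map (a ∷_) (subpid π)

_∡₁_ : Pid → Pid → Set
π ∡₁ π' = ∃ λ a → π' ≡ π ++ [ a ]

_∡_ : Pid → Pid → Set
π ∡ π' = ∃ λ σ → σ ≢ [] × π' ≡ π ++ σ

_⋔₁_ : Pid → Pid → Set
π ⋔₁ π' = ∃ λ π'' → π'' ≢ [] × ∃ λ i →
  π ≡ π'' ++ [ 1+ i ] × π' ≡ π'' ++ [ 1+ (suc i) ]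

_⋔_ : Pid → Pid → Set
π ⋔ π' = ∃ λ π'' → π'' ≢ [] × ∃ λ i → ∃ λ j →
  val⁺ i < val⁺ j × π ≡ π'' ++ [ i ] × π' ≡ π'' ++ [ j ]

data _≤lex_ : Pid → Pid → Set where
  nil  : ∀ {π} → [] ≤lex π
  less : ∀ {a b π π'} → val⁺ a < val⁺ b → (a ∷ π) ≤lex (b ∷ π')
  same : ∀ {a π π'} → π ≤lex π' → (a ∷ π) ≤lex (a ∷ π')

_≤ₕ_ : Pid → Pid → Set
π ≤ₕ π' = length π < length π' ⊎ (length π ≡ length π' × π ≤lex π')

record DataDom : Set₁ where
  field
    𝔻 : Set
    ι : ℕ → 𝔻
    ι-inj : ∀ {x y} → ι x ≡ ι y → x ≡ y

data Ty : Set where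
  𝐏 𝐃 : Ty

module _ (Δ : DataDom) where
  open DataDom Δ

  data Val : Set where
    pid : Pid → Val
    dat : 𝔻 → Val

  dview : Val → Maybe 𝔻
  dview (pid _) = nothing
  dview (dat d) = just d

  data Tok : List Ty → Set where
    []   : Tok []
    _∷ₚ_ : ∀ {ts} → Pid → Tok ts → Tok (𝐏 ∷ ts)
    _∷d_ : ∀ {ts} → 𝔻 → Tok ts → Tok (𝐃 ∷ ts)

  data PidIn (π : Pid) : ∀ {ts} → Tok ts → Set where
    hereₚ : ∀ {ts} {v : Tok ts} → PidIn π (π ∷ₚ v)
    thereₚ : ∀ {ts} {π'} {v : Tok ts} → PidIn π v → PidIn π (π' ∷ₚ v)
    thered : ∀ {ts} {d} {v : Tok ts} → PidIn π v → PidIn π (d ∷d v)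

  -- input-arc components: variables and data values
  data InAtom (nv : ℕ) : Set where
    var : Fin nv → InAtom nv
    cst : 𝔻 → InAtom nv

  -- output-arc components (t-net condition (4)):
  --  dexp e     : an expression over data variables and data values
  --               (semantically: data values of the variables ↦ a data value, possibly undefined)
  --  self i     : p_i with i < m
  --  child i j  : p_i.(c_i + (j+1)) ∈ Π_t, with j < n_i
  data OutAtom (nv k m : ℕ) (n : Fin k → ℕ) : Set where
    dexp  : ((Fin nv → Maybe 𝔻) → Maybe 𝔻) → OutAtom nv k m n
    self  : (i : Fin k) → toℕ i < m → OutAtom nv k m n
    child : (i : Fin k) → Fin (n i) → OutAtom nv k m n

  -- pids that a guard may mention: p_1..p_k and the elements of Π_t
  data PTerm (k : ℕ) (n : Fin k → ℕ) : Set where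
    pin : Fin k → PTerm k n
    pch : (i : Fin k) → Fin (n i) → PTerm k n

  data PRel : Set where
    r= r∡₁ r∡ r⋔₁ r⋔ : PRel

  -- guards (condition (5)): Boolean expressions whose atoms are computable
  -- predicates on the data values of the variables, or comparisons of pids
  -- using =, ∡₁, ∡, ⋔₁, ⋔
  data Guard (nv k : ℕ) (n : Fin k → ℕ) : Set where
    gtrue : Guard nv k n
    gdata : ((Fin nv → Maybe 𝔻) → Bool) → Guard nv k n
    gcmp  : PRel → PTerm k n → PTerm k n → Guard nv k n
    gnot  : Guard nv k n → Guard nv k n
    gand gor : Guard nv k n → Guard nv k n → Guard nv k n

  -- a transition of a t-net over nP non-generator places.
  -- Its variables are Fin nv; p_i = pv i and c_i = cv i (all distinct).
  record Trans (nP : ℕ) : Set where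
    field
      nv  : ℕ
      k   : ℕ
      m   : ℕ
      m≤k : m ≤ k
      pv  : Fin k → Fin nv
      cv  : Fin k → Fin nv
      pv-inj : ∀ i j → pv i ≡ pv j → i ≡ j
      cv-inj : ∀ i j → cv i ≡ cv j → i ≡ j
      pv≢cv  : ∀ i j → pv i ≢ cv j
      n   : Fin k → ℕ
      inArc  : Fin nP → List (List (InAtom nv))
      outArc : Fin nP → List (List (OutAtom nv k m n))
      guard  : Guard nv k n

  -- a t-net: the generator place s_η (type ℙ × ℕ) is kept apart,
  -- the other places are Fin nP with types hd s × tl s
  record TNet : Set where
    field
      nP : ℕ
      hd : Fin nP → Ty
      tl : Fin nP → List Ty
      nT : ℕ
      tr : Fin nT → Trans nP
      init : (s : Fin nP) → List (Tok (hd s ∷ tl s))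
      init-data : ∀ s → init s ≢ [] → All (_≡ 𝐃) (hd s ∷ tl s)

    ty : Fin nP → List Ty
    ty s = hd s ∷ tl s

module _ {Δ : DataDom} (N : TNet Δ) where
  open DataDom Δ
  open TNet N

  -- markings (multisets represented as lists, compared up to permutation)
  record Marking : Set where
    constructor mk
    field
      gen : List (Pid × ℕ)
      tok : (s : Fin nP) → List (Tok Δ (ty s))
  open Marking public

  M₀ : Marking
  M₀ = mk [ (1+ 0 ∷ []) , 0 ] init

  ∅M : Marking
  ∅M = mk [] (λ _ → [])

  single : (s : Fin nP) → Tok Δ (ty s) → Marking
  single s v = mk [] f
    where
    f : (s' : Fin nP) → List (Tok Δ (ty s'))
    f s' with s' ≟F s
    ... | yes refl = [ v ]
    ... | no _ = []

  _⊑M_ : Marking → Marking → Set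
  M' ⊑M M = (∃ λ r → gen M ↭ gen M' ++ r) × (∀ s → ∃ λ r → tok M s ↭ tok M' s ++ r)

  _≈M_ : Marking → Marking → Set
  M' ≈M M = (gen M' ↭ gen M) × (∀ s → tok M' s ↭ tok M s)

  EmptyM : Marking → Set
  EmptyM M = gen M ≡ [] × (∀ s → tok M s ≡ [])

  module _ (t : Trans Δ nP) where
    open Trans t

    data InMatch (β : Fin nv → Val Δ) : List (InAtom Δ nv) → ∀ {ts} → Tok Δ ts → Set where
      []   : InMatch β [] []
      varP : ∀ {x π as ts} {v : Tok Δ ts} → β x ≡ pid π → InMatch β as v → InMatch β (var x ∷ as) (π ∷ₚ v)
      varD : ∀ {x d as ts} {v : Tok Δ ts} → β x ≡ dat d → InMatch β as v → InMatch β (var x ∷ as) (d ∷d v)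
      cstD : ∀ {d as ts} {v : Tok Δ ts} → InMatch β as v → InMatch β (cst d ∷ as) (d ∷d v)

    childPid : (ins : Fin k → Pid × ℕ) → (i : Fin k) → Fin (n i) → Pid
    childPid ins i j = proj₁ (ins i) ++ [ 1+ (proj₂ (ins i) + toℕ j) ]

    data OutMatch (β : Fin nv → Val Δ) (ins : Fin k → Pid × ℕ) : List (OutAtom Δ nv k m n) → ∀ {ts} → Tok Δ ts → Set where
      []    : OutMatch β ins [] []
      dexpO : ∀ {e d as ts} {v : Tok Δ ts} → e (λ x → dview Δ (β x)) ≡ just d → OutMatch β ins as v → OutMatch β ins (dexp e ∷ as) (d ∷d v)
      selfO : ∀ {i p as ts} {v : Tok Δ ts} → OutMatch β ins as v → OutMatch β ins (self i p ∷ as) (proj₁ (ins i) ∷ₚ v)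
      childO : ∀ {i j as ts} {v : Tok Δ ts} → OutMatch β ins as v → OutMatch β ins (child i j ∷ as) (childPid ins i j ∷ₚ v)

    termPid : (ins : Fin k → Pid × ℕ) → PTerm Δ k n → Pid
    termPid ins (pin i) = proj₁ (ins i)
    termPid ins (pch i j) = childPid ins i j

    relSem : PRel Δ → Pid → Pid → Set
    relSem r= π π' = π ≡ π'
    relSem r∡₁ π π' = π ∡₁ π'
    relSem r∡ π π' = π ∡ π'
    relSem r⋔₁ π π' = π ⋔₁ π'
    relSem r⋔ π π' = π ⋔ π'

    Holds : (β : Fin nv → Val Δ) (ins : Fin k → Pid × ℕ) → Guard Δ nv k n → Set
    Holds β ins gtrue = ⊤
    Holds β ins (gdata f) = T (f (λ x → dview Δ (β x)))
    Holds β ins (gcmp r a b) = relSem r (termPid ins a) (termPid ins b)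
    Holds β ins (gnot g) = ¬ Holds β ins g
    Holds β ins (gand g h) = Holds β ins g × Holds β ins h
    Holds β ins (gor g h) = Holds β ins g ⊎ Holds β ins h

    -- tokens put into s_η: ⟨p_i, c_i + n_i⟩ (i < m) and ⟨p_i.(c_i+j), 0⟩ (1 ≤ j ≤ n_i)
    genOut : (ins : Fin k → Pid × ℕ) → List (Pid × ℕ)
    genOut ins =
      tabulate {n = m} (λ i → proj₁ (ins (inject≤ i m≤k)) , proj₂ (ins (inject≤ i m≤k)) + n (inject≤ i m≤k))
      ++ concat (tabulate (λ i → tabulate {n = n i} (λ j → childPid ins i j , 0)))

    -- M —(t,β)→ M' ; ins i = ⟨β(p_i), β(c_i)⟩ is the token consumed from s_η
    record Fires (M : Marking) (β : Fin nv → Val Δ) (ins : Fin k → Pid × ℕ) (M' : Marking) : Set where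
      field
        bind-p  : ∀ i → β (pv i) ≡ pid (proj₁ (ins i))
        bind-c  : ∀ i → β (cv i) ≡ dat (ι (proj₂ (ins i)))
        genRest : List (Pid × ℕ)
        genIn   : gen M ↭ tabulate ins ++ genRest
        genOutM : gen M' ↭ genOut ins ++ genRest
        consumed : (s : Fin nP) → List (Tok Δ (ty s))
        consumedOk : ∀ s → Pointwise (λ as v → InMatch β as v) (inArc s) (consumed s)
        produced : (s : Fin nP) → List (Tok Δ (ty s))
        producedOk : ∀ s → Pointwise (λ as v → OutMatch β ins as v) (outArc s) (produced s)
        rest    : (s : Fin nP) → List (Tok Δ (ty s))
        tokIn   : ∀ s → tok M s ↭ consumed s ++ rest s
        tokOut  : ∀ s → tok M' s ↭ produced s ++ rest s
        guardOk : Holds β ins guard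

  Step : Marking → Marking → Set
  Step M M' = Σ (Fin nT) λ t → let open Trans (tr t) in
    Σ (Fin nv → Val Δ) λ β → Σ (Fin k → Pid × ℕ) λ ins → Fires (tr t) M β ins M'

  Reachable : Marking → Set
  Reachable M = Star Step M₀ M

  _∈pidM_ : Pid → Marking → Set
  π ∈pidM M = (∃ λ c → (π , c) ∈ gen M) ⊎ (∃ λ s → ∃ λ v → v ∈ tok M s × PidIn Δ π v)

  _∈nextpid_ : Pid → Marking → Set
  π ∈nextpid M = ∃ λ π' → ∃ λ c → (π' , c) ∈ gen M × π ≡ π' ++ [ 1+ c ]

  data Tree : Set where
    node : Marking → List (Pid × Tree) → Tree

  rootM : Tree → Marking
  rootM (node M _) = M

  data WF : Tree → Set where
    wf : ∀ {M cs} →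
      All (λ c → proj₁ c ≢ [] × WF (proj₂ c)) cs →
      AllPairs (λ c c' → proj₁ c ≢ proj₁ c' × ¬ (proj₁ c ∈ subpid (proj₁ c')) × ¬ (proj₁ c' ∈ subpid (proj₁ c))) cs →
      WF (node M cs)

  data _⊆T_ : Tree → Tree → Set where
    incl : ∀ {M' cs' M cs} → M' ⊑M M →
      All (λ c' → Any (λ c → proj₁ c' ≡ proj₁ c × proj₂ c' ⊆T proj₂ c) cs) cs' →
      node M' cs' ⊆T node M cs

  data Sub : Tree → Pid → Tree → Set where
    here  : ∀ {t} → Sub t [] t
    there : ∀ {M cs a ti π t'} → (a , ti) ∈ cs → Sub ti π t' → Sub (node M cs) (a ++ π) t'

  _∈pidT_ : Pid → Tree → Set
  π ∈pidT t = ∃ λ t' → Sub t π t'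

  SiblingOrdered : Tree → Set
  SiblingOrdered t = ∀ π M cs → Sub t π (node M cs) → Linked _≤ₕ_ (map proj₁ cs)

  IsPath : Pid → Marking → Tree → Set
  IsPath π M' t =
    WF t × π ∈pidT t × (∀ ρ → ρ ∈pidT t → ρ ∈ subpid π ⊎ ρ ≡ []) ×
    Sub t π (node M' []) ×
    (∀ ρ t' → Sub t ρ t' → ρ ≢ π → EmptyM (rootM t'))

  ContainsPath : Tree → Pid → Marking → Set
  ContainsPath R π M' = ∃ λ t → IsPath π M' t × t ⊆T R

  -- node at which a token of a non-generator place is deposited:
  -- ⟨⟩ (shared-token rule, X₁ = 𝔻) or x₁ (owned-token rule, X₁ = ℙ)
  depositAt : ∀ {ts} → Tok Δ ts → Pid
  depositAt [] = []
  depositAt (x ∷ₚ _) = x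
  depositAt (_ ∷d _) = []

  deposit : Marking → Pid → Marking
  deposit M π = mk [] (λ s → filter (λ v → depositAt v ≟ₚ π) (tok M s))

  -- pids π for which some rule requires path(π, _)
  Required : Marking → Pid → Set
  Required M π = (∃ λ c → (π , c) ∈ gen M)
               ⊎ (∃ λ π' → ∃ λ c → (π' , c) ∈ gen M × π ≡ π' ++ [ 1+ c ])
               ⊎ (∃ λ s → ∃ λ v → v ∈ tok M s × (π ≡ depositAt v ⊎ PidIn Δ π v))

  record _∈repr_ (R : Tree) (M : Marking) : Set where
    field
      isTree    : WF R
      ordered   : SiblingOrdered R
      genRule   : ∀ π c → (π , c) ∈ gen M →
                  ContainsPath R π ∅M × ContainsPath R (π ++ [ 1+ c ]) ∅M
      tokRule   : ∀ s v → v ∈ tok M s →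
                  ContainsPath R (depositAt v) (single s v) ×
                  (∀ x → PidIn Δ x v → ContainsPath R x ∅M)
      onlyNodes : ∀ π → π ∈pidT R → π ≡ [] ⊎ ∃ λ ρ → Required M ρ × π ∈ subpid ρ
      onlyToks  : ∀ π t' → Sub R π t' → rootM t' ≈M deposit M π

module Submission where

-- The two inclusions are proved separately from the representation rules.
--  * Lower bound: every active pid and every next pid is required by the
--    generator or token rules to label a path contained in R, and the label
--    of such a path is a node of R (tree inclusion transports subtrees).
--  * Upper bound: R has no nodes beyond the prefixes of required pids, and
--    each required pid is active (generator or token pid), a next pid, or
--    the node where a token is deposited (again an active pid when nonempty).
--    The prefixes of a next pid π.(c+1) are π.(c+1) itself or prefixes of π.
--  * Nonemptiness: ⟨⟩ is never active, by an invariant of reachable markings: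
--    the initial marking only contains the pid 1, and firing a transition
--    only emits input pids p_i and their children p_i.(c_i+j).
-- Only the last point uses reachability; the inclusions hold for any M.

open import Defs
open import Data.List using ([])
open import Data.List.Membership.Propositional using (_∈_)
open import Data.Product using (∃; _×_)
open import Data.Sum using (_⊎_)
open import Relation.Binary.PropositionalEquality using (_≢_)

open import Data.Nat using (ℕ)
open import Data.List using (List; _∷_; _++_; [_]; tabulate)
open import Data.List.Properties using (++-conicalʳ)
open import Data.List.Membership.Propositional using (find)
open import Data.List.Membership.Propositional.Properties
  using (∈-++⁻; ∈-++⁺ˡ; ∈-++⁺ʳ; ∈-map⁺; ∈-map⁻; ∈-tabulate⁺; ∈-tabulate⁻; ∈-concat⁻′)
open import Data.List.Relation.Unary.Any using (here; there)
open import Data.List.Relation.Unary.All using (All; _∷_) renaming (lookup to All-lookup)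
open import Data.List.Relation.Binary.Pointwise using (Pointwise; _∷_)
open import Data.List.Relation.Binary.Permutation.Propositional using (↭-sym)
open import Data.List.Relation.Binary.Permutation.Propositional.Properties using (∈-resp-↭)
open import Data.Product using (_,_; proj₁; proj₂)
open import Data.Sum using (inj₁; inj₂)
open import Data.Fin using (Fin)
open import Data.Empty using (⊥; ⊥-elim)
open import Relation.Binary.PropositionalEquality using (_≡_; refl; cong)
open import Relation.Binary.Construct.Closure.ReflexiveTransitive using (Star; ε; _◅_)

snoc≢[] : ∀ {A : Set} (xs : List A) (a : A) → xs ++ [ a ] ≢ []
snoc≢[] xs a eq with ++-conicalʳ xs [ a ] eq
... | ()

subpid-snoc : ∀ π a ρ → ρ ∈ subpid (π ++ [ a ]) → ρ ∈ subpid π ⊎ ρ ≡ π ++ [ a ]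
subpid-snoc []      a ρ (here eq) = inj₂ eq
subpid-snoc (b ∷ π) a ρ (here eq) = inj₁ (here eq)
subpid-snoc (b ∷ π) a ρ (there mem) with ∈-map⁻ (b ∷_) mem
... | ρ' , mem' , refl with subpid-snoc π a ρ' mem'
...   | inj₁ pre = inj₁ (there (∈-map⁺ (b ∷_) pre))
...   | inj₂ eq  = inj₂ (cong (b ∷_) eq)

subpid-nonEmpty : ∀ {π ρ} → π ∈ subpid ρ → ρ ≢ []
subpid-nonEmpty {ρ = _ ∷ _} _ ()

module _ {Δ : DataDom} (N : TNet Δ) where
  open TNet N

  NonEmptyPids : Marking N → Set
  NonEmptyPids M = ∀ π → _∈pidM_ N π M → π ≢ []

  dataTok-noPid : ∀ {ts} {v : Tok Δ ts} {π} → All (_≡ 𝐃) ts → PidIn Δ π v → ⊥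
  dataTok-noPid (() ∷ _) hereₚ
  dataTok-noPid (() ∷ _) (thereₚ _)
  dataTok-noPid (_ ∷ ds) (thered p) = dataTok-noPid ds p

  -- Initially only the pid 1 is active: the other places hold data only.
  nonEmpty-M₀ : NonEmptyPids (M₀ N)
  nonEmpty-M₀ π (inj₁ (c , here refl)) ()
  nonEmpty-M₀ π (inj₂ (s , v , mem , p)) =
    ⊥-elim (dataTok-noPid (init-data s (λ empty → nonEmpty empty mem)) p)
    where
    nonEmpty : ∀ {A : Set} {xs : List A} {x} → xs ≡ [] → x ∈ xs → ⊥
    nonEmpty refl ()

  module _ (t : Trans Δ nP) where
    open Trans t

    Emitted : (Fin k → Pid × ℕ) → Pid → Set
    Emitted ins π = (∃ λ i → π ≡ proj₁ (ins i)) ⊎ (∃ λ i → ∃ λ j → π ≡ childPid N t ins i j)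

    emitted≢[] : ∀ {ins π} → (∀ i → proj₁ (ins i) ≢ []) → Emitted ins π → π ≢ []
    emitted≢[] inputs (inj₁ (i , refl)) = inputs i
    emitted≢[] {ins} _ (inj₂ (i , j , refl)) = snoc≢[] (proj₁ (ins i)) _

    genOut-emitted : ∀ ins π c → (π , c) ∈ genOut N t ins → Emitted ins π
    genOut-emitted ins π c mem with ∈-++⁻ (tabulate {n = m} _) mem
    ... | inj₁ kept with ∈-tabulate⁻ kept
    ...   | i , refl = inj₁ (_ , refl)
    genOut-emitted ins π c mem | inj₂ spawned with ∈-concat⁻′ _ spawned
    ... | _ , inner , outer with ∈-tabulate⁻ {f = λ i → tabulate {n = n i} (λ j → childPid N t ins i j , 0)} outer
    ...   | i , refl with ∈-tabulate⁻ inner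
    ...     | j , refl = inj₂ (i , j , refl)

    outToken-emitted : ∀ {β ins as ts} {v : Tok Δ ts} {π} →
      OutMatch N t β ins as v → PidIn Δ π v → Emitted ins π
    outToken-emitted (dexpO _ o) (thered p) = outToken-emitted o p
    outToken-emitted (selfO o)   hereₚ      = inj₁ (_ , refl)
    outToken-emitted (selfO o)   (thereₚ p) = outToken-emitted o p
    outToken-emitted (childO o)  hereₚ      = inj₂ (_ , _ , refl)
    outToken-emitted (childO o)  (thereₚ p) = outToken-emitted o p

    outTokens-emitted : ∀ {β ins ts} {ass : List (List (OutAtom Δ nv k m n))} {vs : List (Tok Δ ts)} →
      Pointwise (λ as v → OutMatch N t β ins as v) ass vs → ∀ {v π} → v ∈ vs → PidIn Δ π v → Emitted ins π
    outTokens-emitted (o ∷ _)  (here refl) = outToken-emitted o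
    outTokens-emitted (_ ∷ os) (there mem) = outTokens-emitted os mem

  -- Firing preserves the invariant: a pid of M' is either left untouched
  -- from M or emitted from input pids, which are active in M.
  nonEmpty-step : ∀ {M M'} → NonEmptyPids M → Step N M M' → NonEmptyPids M'
  nonEmpty-step {M} {M'} old (t , β , ins , F) = new
    where
    open Trans (tr t)
    open Fires F
    fromM-gen : ∀ {x} → x ∈ genRest → x ∈ gen M
    fromM-gen mem = ∈-resp-↭ (↭-sym genIn) (∈-++⁺ʳ (tabulate ins) mem)
    inputs : ∀ i → proj₁ (ins i) ≢ []
    inputs i = old _ (inj₁ (_ , ∈-resp-↭ (↭-sym genIn) (∈-++⁺ˡ (∈-tabulate⁺ i))))
    new : NonEmptyPids M'
    new π (inj₁ (c , mem)) with ∈-++⁻ (genOut N (tr t) ins) (∈-resp-↭ genOutM mem)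
    ... | inj₁ out  = emitted≢[] (tr t) inputs (genOut-emitted (tr t) ins π c out)
    ... | inj₂ kept = old π (inj₁ (c , fromM-gen kept))
    new π (inj₂ (s , v , mem , p)) with ∈-++⁻ (produced s) (∈-resp-↭ (tokOut s) mem)
    ... | inj₁ out  = emitted≢[] (tr t) inputs (outTokens-emitted (tr t) (producedOk s) out p)
    ... | inj₂ kept = old π (inj₂ (s , v , ∈-resp-↭ (↭-sym (tokIn s)) (∈-++⁺ʳ (consumed s) kept) , p))

  nonEmpty-reachable : ∀ {M} → Reachable N M → NonEmptyPids M
  nonEmpty-reachable = go nonEmpty-M₀
    where
    go : ∀ {M M'} → NonEmptyPids M → Star (Step N) M M' → NonEmptyPids M'
    go inv ε = inv
    go inv (step ◅ steps) = go (nonEmpty-step inv step) steps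

  -- A node of an included tree is a node of the larger tree: inclusion
  -- matches every child label with an equal child label.
  ⊆T-pid : ∀ {t π t' R} → Sub N t π t' → _⊆T_ N t R → _∈pidT_ N π R
  ⊆T-pid {R = R} here _ = R , here
  ⊆T-pid (there mem sub) (incl _ children) with find (All-lookup children mem)
  ... | _ , mem' , refl , child⊆ with ⊆T-pid sub child⊆
  ...   | t'' , sub' = t'' , there mem' sub'

  path-pid : ∀ {R π M'} → ContainsPath N R π M' → _∈pidT_ N π R
  path-pid (_ , (_ , _ , _ , end , _) , path⊆R) = ⊆T-pid end path⊆R

  deposit-owner : ∀ {ts} (v : Tok Δ ts) → depositAt N v ≢ [] → PidIn Δ (depositAt N v) v
  deposit-owner []       nonEmpty = ⊥-elim (nonEmpty refl)
  deposit-owner (x ∷ₚ v) _        = hereₚ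
  deposit-owner (d ∷d v) nonEmpty = ⊥-elim (nonEmpty refl)

  -- Lower bound: the generator and token rules put every active pid and
  -- every next pid on a path of R.
  repr-lower : ∀ {R M π} → _∈repr_ N R M →
    _∈pidM_ N π M ⊎ _∈nextpid_ N π M → _∈pidT_ N π R
  repr-lower rep (inj₁ (inj₁ (c , mem))) =
    path-pid (proj₁ (_∈repr_.genRule rep _ c mem))
  repr-lower rep (inj₁ (inj₂ (s , v , mem , p))) =
    path-pid (proj₂ (_∈repr_.tokRule rep s v mem) _ p)
  repr-lower rep (inj₂ (π' , c , mem , refl)) =
    path-pid (proj₂ (_∈repr_.genRule rep π' c mem))

  required-covered : ∀ {M ρ π} → Required N M ρ → π ∈ subpid ρ →
    (∃ λ σ → _∈pidM_ N σ M × π ∈ subpid σ) ⊎ _∈nextpid_ N π M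
  required-covered (inj₁ gen∋ρ) pre = inj₁ (_ , inj₁ gen∋ρ , pre)
  required-covered {π = π} (inj₂ (inj₁ (π' , c , mem , refl))) pre with subpid-snoc π' (1+ c) π pre
  ... | inj₁ pre' = inj₁ (π' , inj₁ (c , mem) , pre')
  ... | inj₂ eq   = inj₂ (π' , c , mem , eq)
  required-covered (inj₂ (inj₂ (s , v , mem , inj₂ p))) pre = inj₁ (_ , inj₂ (s , v , mem , p) , pre)
  required-covered (inj₂ (inj₂ (s , v , mem , inj₁ refl))) pre =
    inj₁ (_ , inj₂ (s , v , mem , deposit-owner v (subpid-nonEmpty pre)) , pre)

  repr-upper : ∀ {R M π} → _∈repr_ N R M → _∈pidT_ N π R → π ≢ [] →
    (∃ λ σ → _∈pidM_ N σ M × π ∈ subpid σ) ⊎ _∈nextpid_ N π M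
  repr-upper rep isNode nonEmpty with _∈repr_.onlyNodes rep _ isNode
  ... | inj₁ empty           = ⊥-elim (nonEmpty empty)
  ... | inj₂ (ρ , req , pre) = required-covered req pre

proposition1 : (Δ : DataDom) (N : TNet Δ) (M : Marking N) → Reachable N M →
    (R : Tree N) → _∈repr_ N R M →
    (∀ π → (_∈pidM_ N π M ⊎ _∈nextpid_ N π M) → _∈pidT_ N π R × π ≢ []) ×
    (∀ π → _∈pidT_ N π R × π ≢ [] →
      (∃ λ σ → _∈pidM_ N σ M × π ∈ subpid σ) ⊎ _∈nextpid_ N π M)
proposition1 Δ N M reachable R rep = lower , upper
  where
  -- a next pid π'.(c+1) is nonempty; an active pid is by the invariant
  nonEmpty : ∀ π → _∈pidM_ N π M ⊎ _∈nextpid_ N π M → π ≢ []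
  nonEmpty π (inj₁ active)              = nonEmpty-reachable N reachable π active
  nonEmpty π (inj₂ (π' , c , _ , refl)) = snoc≢[] π' (1+ c)

  lower : ∀ π → _∈pidM_ N π M ⊎ _∈nextpid_ N π M → _∈pidT_ N π R × π ≢ []
  lower π h = repr-lower N rep h , nonEmpty π h

  upper : ∀ π → _∈pidT_ N π R × π ≢ [] →
    (∃ λ σ → _∈pidM_ N σ M × π ∈ subpid σ) ⊎ _∈nextpid_ N π M
  upper π (isNode , nonEmpty') = repr-upper N rep isNode nonEmpty'
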